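{- Let $\gamma_1,\dots,\gamma_n\in\mathbb{H}(\mathbb{Z})$ and suppose $\mathbb{K}\{\gamma_i\}_{i=1}^n:=\iota\big(\gamma_1*\iota(\gamma_2*\cdots\iota(\gamma_n)\cdots)\big)$ is defined. Then, in the projective Siegel model, $\mathbb{K}\{\gamma_i\}_{i=1}^n$ is the point $A_{\gamma_1}A_{\gamma_2}\cdots A_{\gamma_n}(1:0:0)\in\mathbb{CP}^2$.
   Context: The Heisenberg group $\mathbb{H}$ is $\mathbb{C}\times\mathbb{R}$ with group law $(z,t)*(z',t')=(z+z',\,t+t'+2\,\mathrm{Im}(\overline{z}z'))$. Korányi inversion $\iota(z,t)=\left(\frac{ -z}{|z|^2+\mathrm{i}t},\frac{ -t}{|z|^4+t^2}\right)$ on $\mathbb{H}\setminus\{0\}$. $\mathbb{H}(\mathbb{Z})=\mathbb{Z}[\mathrm{i}]\times\mathbb{Z}$. In the projective Siegel model, $(z,t)\in\mathbb{H}$ is identified with the point of $\mathbb{CP}^2$ with homogeneous coordinates $(1:z(1+\mathrm{i}):|z|^2+\mathrm{i}t)$; $3\times3$ complex matrices act on $\mathbb{CP}^2$ linearly on homogeneous coordinates. The planar Siegel coordinates of $(z,t)$ are $(z(1+\mathrm{i}),|z|^2+\mathrm{i}t)$; for $\gamma\in\mathbb{H}(\mathbb{Z})$ with planar Siegel coordinates $(\alpha,\beta)$, $A_\gamma=\begin{pmatrix}-\beta&-\overline{\alpha}&-1\\ \alpha&1&0\\ -1&0&0\end{pmatrix}$. -}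

module Defs where

open import Data.Integer.Base as ℤ using (ℤ)
open import Data.Rational.Base as Q using (ℚ; 0ℚ; 1ℚ; ≢-nonZero)
open import Data.Rational.Properties using (_≟_)
open import Data.Product.Base using (_×_; _,_; ∃)
open import Data.Maybe.Base using (Maybe; just; nothing; _>>=_)
open import Data.List.Base using (List; []; _∷_)
open import Data.Fin.Base using (Fin; zero; suc)
open import Relation.Nullary using (yes; no; ¬_)
open import Relation.Binary.PropositionalEquality using (_≡_)

-- Gaussian rationals ℚ(i): re + i·im.  (All points that occur are of this form.)
record ℚi : Set where
  constructor _+i_
  field
    re im : ℚ
open ℚi public

infixl 6 _⊕_
infixl 7 _⊗_

_⊕_ : ℚi → ℚi → ℚi
(a +i b) ⊕ (c +i d) = (a Q.+ c) +i (b Q.+ d)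

_⊗_ : ℚi → ℚi → ℚi
(a +i b) ⊗ (c +i d) = (a Q.* c Q.- b Q.* d) +i (a Q.* d Q.+ b Q.* c)

⊝_ : ℚi → ℚi
⊝ (a +i b) = (Q.- a) +i (Q.- b)

conj : ℚi → ℚi
conj (a +i b) = a +i (Q.- b)

normSq : ℚi → ℚ
normSq (a +i b) = a Q.* a Q.+ b Q.* b

ofℚ : ℚ → ℚi
ofℚ q = q +i 0ℚ

scale : ℚ → ℚi → ℚi
scale q (a +i b) = (q Q.* a) +i (q Q.* b)

0i 1i iI : ℚi
0i = 0ℚ +i 0ℚ
1i = 1ℚ +i 0ℚ
iI = 0ℚ +i 1ℚ

H : Set
H = ℚi × ℚ

_*H_ : H → H → H
(z , t) *H (z' , t') = (z ⊕ z') , (t Q.+ t' Q.+ (ℤ.+ 2 Q./ 1) Q.* im (conj z ⊗ z'))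

-- Korányi gauge to the 4th: |z|^4 + t^2 ; zero exactly at the origin
gauge4 : H → ℚ
gauge4 (z , t) = normSq z Q.* normSq z Q.+ t Q.* t

-- Korányi inversion; undefined (nothing) at the origin.
-- ι(z,t) = ( -z / (|z|^2 + i t) , -t / (|z|^4 + t^2) ),
-- where 1/w = conj w / |w|^2 and |(|z|^2 + i t)|^2 = |z|^4 + t^2.
ι : H → Maybe H
ι (z , t) with gauge4 (z , t) ≟ 0ℚ
... | yes _ = nothing
... | no N≢0 =
  let instance _ = ≢-nonZero N≢0
      N = gauge4 (z , t)
      w = normSq z +i t
  in just (scale (Q.1/ N) (⊝ z ⊗ conj w) , Q.- (t Q.* (Q.1/ N)))

Hℤ : Set
Hℤ = (ℤ × ℤ) × ℤ

toH : Hℤ → H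
toH ((a , b) , c) = ((a Q./ 1) +i (b Q./ 1)) , (c Q./ 1)

-- K{γ₁,…,γₙ} = ι(γ₁ * ι(γ₂ * ⋯ ι(γₙ) ⋯)), for the nonempty list γ₁ ∷ (γ₂ … γₙ);
-- 'nothing' when some inversion is applied at the origin (i.e. K is not defined).
K : Hℤ → List Hℤ → Maybe H
K γ [] = ι (toH γ)
K γ (δ ∷ δs) = K δ δs >>= λ p → ι (toH γ *H p)

Vec3 : Set
Vec3 = Fin 3 → ℚi

Mat3 : Set
Mat3 = Fin 3 → Fin 3 → ℚi

mat3 : ℚi → ℚi → ℚi → ℚi → ℚi → ℚi → ℚi → ℚi → ℚi → Mat3
mat3 a b c d e f g h k zero zero = a
mat3 a b c d e f g h k zero (suc zero) = b
mat3 a b c d e f g h k zero (suc (suc zero)) = c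
mat3 a b c d e f g h k (suc zero) zero = d
mat3 a b c d e f g h k (suc zero) (suc zero) = e
mat3 a b c d e f g h k (suc zero) (suc (suc zero)) = f
mat3 a b c d e f g h k (suc (suc zero)) zero = g
mat3 a b c d e f g h k (suc (suc zero)) (suc zero) = h
mat3 a b c d e f g h k (suc (suc zero)) (suc (suc zero)) = k

vec3 : ℚi → ℚi → ℚi → Vec3
vec3 a b c zero = a
vec3 a b c (suc zero) = b
vec3 a b c (suc (suc zero)) = c

_·M_ : Mat3 → Mat3 → Mat3
(A ·M B) i j = A i zero ⊗ B zero j ⊕ A i (suc zero) ⊗ B (suc zero) j ⊕ A i (suc (suc zero)) ⊗ B (suc (suc zero)) j

_·v_ : Mat3 → Vec3 → Vec3
(A ·v v) i = A i zero ⊗ v zero ⊕ A i (suc zero) ⊗ v (suc zero) ⊕ A i (suc (suc zero)) ⊗ v (suc (suc zero))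

I3 : Mat3
I3 = mat3 1i 0i 0i 0i 1i 0i 0i 0i 1i

prodM : List Mat3 → Mat3
prodM [] = I3
prodM (M ∷ Ms) = M ·M prodM Ms

siegelα : H → ℚi
siegelα (z , t) = z ⊗ (1i ⊕ iI)

siegelβ : H → ℚi
siegelβ (z , t) = ofℚ (normSq z) ⊕ (iI ⊗ ofℚ t)

siegelHom : H → Vec3
siegelHom p = vec3 1i (siegelα p) (siegelβ p)

Aγ : Hℤ → Mat3
Aγ γ = mat3 (⊝ β) (⊝ conj α) (⊝ 1i)
            α      1i         0i
            (⊝ 1i) 0i         0i
  where
    α = siegelα (toH γ)
    β = siegelβ (toH γ)

e₀ : Vec3
e₀ = vec3 1i 0i 0i

-- equality of points of ℂP²: v = λ w for some nonzero scalar λ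
-- (w ≠ 0 is automatic below since siegelHom has first coordinate 1)
_≈P_ : Vec3 → Vec3 → Set
v ≈P w = ∃ λ (c : ℚi) → ¬ (c ≡ 0i) × (∀ k → v k ≡ c ⊗ w k)

{-# OPTIONS --safe #-}
-- The matrix A_g first translates by g and then inverts: on the Siegel point of q it
-- gives (−β : α : −1) in the planar Siegel coordinates (α , β) of g * q, and dividing
-- by −β, whose norm is the Korányi gauge |z|⁴ + t² of g * q, yields exactly the
-- Siegel point of ι (g * q).  Since (1 : 0 : 0) is the Siegel point of the origin,
-- induction on the number of factors gives the theorem.
module Submission where

open import Defs
open import Level using (0ℓ)
open import Data.Nat.Base using (ℕ)
open import Data.Fin.Base using (Fin; zero; suc)
open import Data.Integer.Base as ℤ using ()
open import Data.Rational.Base as Q using (ℚ; 0ℚ; 1ℚ; ≢-nonZero)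
import Data.Rational.Properties as QP
open import Data.Product.Base using (_×_; _,_; proj₁; proj₂; ∃)
open import Data.List.Base using (List; []; _∷_; map)
open import Data.Maybe.Base using (Maybe; just; nothing; _>>=_)
open import Relation.Nullary using (yes; no)
open import Relation.Nullary.Decidable.Core using (dec⇒maybe)
open import Function.Base using (_∘_)
open import Relation.Binary.PropositionalEquality
open import Algebra.Structures {A = ℚi} _≡_ using (IsCommutativeMonoid)
open import Algebra.Structures.Biased {A = ℚi} _≡_
  using (isCommutativeMonoidˡ; isCommutativeSemiringˡ)
open import Algebra.Apartness.Properties.HeytingCommutativeRing QP.heytingCommutativeRing
  using (x#0y#0→xy#0)
open import Tactic.RingSolver.Core.Expression
  using (Expr; Κ) renaming (_⊕_ to _:+_; _⊗_ to _:*_; ⊝_ to :-_)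
open import Tactic.RingSolver.Core.AlmostCommutativeRing
  using (AlmostCommutativeRing; fromCommutativeRing)
import Tactic.RingSolver.NonReflective as RingSolver

ℚ-almostCommutativeRing : AlmostCommutativeRing 0ℓ 0ℓ
ℚ-almostCommutativeRing =
  fromCommutativeRing QP.+-*-commutativeRing (λ x → dec⇒maybe (0ℚ QP.≟ x))

module ℚ-Solver = RingSolver ℚ-almostCommutativeRing
open ℚ-Solver using (_⊜_)

-- Polynomial expressions over ℚ mirroring the operations of Defs on real and imaginary
-- parts, so that evaluating a mirrored expression is definitionally the original term.
module _ {n : ℕ} where

  ℚiExpr : Set
  ℚiExpr = Expr ℚ n × Expr ℚ n

  HExpr : Set
  HExpr = ℚiExpr × Expr ℚ n

  infixl 6 _⊕ᴱ_
  infixl 7 _⊗ᴱ_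

  _⊕ᴱ_ _⊗ᴱ_ : ℚiExpr → ℚiExpr → ℚiExpr
  (a , b) ⊕ᴱ (c , d) = a :+ c , b :+ d
  (a , b) ⊗ᴱ (c , d) = a :* c :+ :- (b :* d) , a :* d :+ b :* c

  ⊝ᴱ_ conjᴱ : ℚiExpr → ℚiExpr
  ⊝ᴱ (a , b) = :- a , :- b
  conjᴱ (a , b) = a , :- b

  normSqᴱ : ℚiExpr → Expr ℚ n
  normSqᴱ (a , b) = a :* a :+ b :* b

  ofℚᴱ : Expr ℚ n → ℚiExpr
  ofℚᴱ q = q , Κ 0ℚ

  0ᴱ 1ᴱ iᴱ : ℚiExpr
  0ᴱ = Κ 0ℚ , Κ 0ℚ
  1ᴱ = Κ 1ℚ , Κ 0ℚ
  iᴱ = Κ 0ℚ , Κ 1ℚ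

  scaleᴱ : Expr ℚ n → ℚiExpr → ℚiExpr
  scaleᴱ q (a , b) = q :* a , q :* b

  siegelαᴱ siegelβᴱ : HExpr → ℚiExpr
  siegelαᴱ (z , t) = z ⊗ᴱ (1ᴱ ⊕ᴱ iᴱ)
  siegelβᴱ (z , t) = ofℚᴱ (normSqᴱ z) ⊕ᴱ iᴱ ⊗ᴱ ofℚᴱ t

  gauge4ᴱ : HExpr → Expr ℚ n
  gauge4ᴱ (z , t) = normSqᴱ z :* normSqᴱ z :+ t :* t

  _*Hᴱ_ : HExpr → HExpr → HExpr
  (z , t) *Hᴱ (z' , t') = z ⊕ᴱ z' , t :+ t' :+ Κ (ℤ.+ 2 Q./ 1) :* proj₂ (conjᴱ z ⊗ᴱ z')

  inversionByᴱ : Expr ℚ n → HExpr → HExpr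
  inversionByᴱ u (z , t) = scaleᴱ u (⊝ᴱ z ⊗ᴱ conjᴱ (normSqᴱ z , t)) , :- (t :* u)

  vec3ᴱ : ℚiExpr → ℚiExpr → ℚiExpr → Fin 3 → ℚiExpr
  vec3ᴱ a b c zero = a
  vec3ᴱ a b c (suc zero) = b
  vec3ᴱ a b c (suc (suc zero)) = c

  _·vᴱ_ : (Fin 3 → Fin 3 → ℚiExpr) → (Fin 3 → ℚiExpr) → Fin 3 → ℚiExpr
  (A ·vᴱ v) i = A i zero ⊗ᴱ v zero ⊕ᴱ A i (suc zero) ⊗ᴱ v (suc zero) ⊕ᴱ A i (suc (suc zero)) ⊗ᴱ v (suc (suc zero))

  siegelHomᴱ inversionHomᴱ : HExpr → Fin 3 → ℚiExpr
  siegelHomᴱ p = vec3ᴱ 1ᴱ (siegelαᴱ p) (siegelβᴱ p)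
  inversionHomᴱ p = vec3ᴱ (⊝ᴱ siegelβᴱ p) (siegelαᴱ p) (⊝ᴱ 1ᴱ)

  siegelMatrixᴱ : HExpr → Fin 3 → Fin 3 → ℚiExpr
  siegelMatrixᴱ p zero = vec3ᴱ (⊝ᴱ siegelβᴱ p) (⊝ᴱ conjᴱ (siegelαᴱ p)) (⊝ᴱ 1ᴱ)
  siegelMatrixᴱ p (suc zero) = vec3ᴱ (siegelαᴱ p) 1ᴱ 0ᴱ
  siegelMatrixᴱ p (suc (suc zero)) = vec3ᴱ (⊝ᴱ 1ᴱ) 0ᴱ 0ᴱ

  reᴱ imᴱ : ℚiExpr × ℚiExpr → Expr ℚ n × Expr ℚ n
  reᴱ ((a , _) , (c , _)) = a ⊜ c
  imᴱ ((_ , b) , (_ , d)) = b ⊜ d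

  translationᴱ : (a b c x y s : Expr ℚ n) → Fin 3 → ℚiExpr × ℚiExpr
  translationᴱ a b c x y s k =
    (siegelMatrixᴱ g ·vᴱ siegelHomᴱ q) k , inversionHomᴱ (g *Hᴱ q) k
    where
    g q : HExpr
    g = (a , b) , c
    q = (x , y) , s

ℚi-≡ : ∀ {u v : ℚi} → re u ≡ re v → im u ≡ im v → u ≡ v
ℚi-≡ = cong₂ _+i_

⊕-assoc : ∀ x y z → (x ⊕ y) ⊕ z ≡ x ⊕ (y ⊕ z)
⊕-assoc (a +i b) (c +i d) (e +i f) = ℚi-≡
  (ℚ-Solver.solve 6 (λ a b c d e f → reᴱ (((a , b) ⊕ᴱ (c , d)) ⊕ᴱ (e , f) , (a , b) ⊕ᴱ ((c , d) ⊕ᴱ (e , f)))) refl a b c d e f)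
  (ℚ-Solver.solve 6 (λ a b c d e f → imᴱ (((a , b) ⊕ᴱ (c , d)) ⊕ᴱ (e , f) , (a , b) ⊕ᴱ ((c , d) ⊕ᴱ (e , f)))) refl a b c d e f)

⊕-comm : ∀ x y → x ⊕ y ≡ y ⊕ x
⊕-comm (a +i b) (c +i d) = ℚi-≡
  (ℚ-Solver.solve 4 (λ a b c d → reᴱ ((a , b) ⊕ᴱ (c , d) , (c , d) ⊕ᴱ (a , b))) refl a b c d)
  (ℚ-Solver.solve 4 (λ a b c d → imᴱ ((a , b) ⊕ᴱ (c , d) , (c , d) ⊕ᴱ (a , b))) refl a b c d)

⊕-identityˡ : ∀ x → 0i ⊕ x ≡ x
⊕-identityˡ (a +i b) = ℚi-≡
  (ℚ-Solver.solve 2 (λ a b → reᴱ (0ᴱ ⊕ᴱ (a , b) , (a , b))) refl a b)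
  (ℚ-Solver.solve 2 (λ a b → imᴱ (0ᴱ ⊕ᴱ (a , b) , (a , b))) refl a b)

⊗-assoc : ∀ x y z → (x ⊗ y) ⊗ z ≡ x ⊗ (y ⊗ z)
⊗-assoc (a +i b) (c +i d) (e +i f) = ℚi-≡
  (ℚ-Solver.solve 6 (λ a b c d e f → reᴱ (((a , b) ⊗ᴱ (c , d)) ⊗ᴱ (e , f) , (a , b) ⊗ᴱ ((c , d) ⊗ᴱ (e , f)))) refl a b c d e f)
  (ℚ-Solver.solve 6 (λ a b c d e f → imᴱ (((a , b) ⊗ᴱ (c , d)) ⊗ᴱ (e , f) , (a , b) ⊗ᴱ ((c , d) ⊗ᴱ (e , f)))) refl a b c d e f)

⊗-comm : ∀ x y → x ⊗ y ≡ y ⊗ x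
⊗-comm (a +i b) (c +i d) = ℚi-≡
  (ℚ-Solver.solve 4 (λ a b c d → reᴱ ((a , b) ⊗ᴱ (c , d) , (c , d) ⊗ᴱ (a , b))) refl a b c d)
  (ℚ-Solver.solve 4 (λ a b c d → imᴱ ((a , b) ⊗ᴱ (c , d) , (c , d) ⊗ᴱ (a , b))) refl a b c d)

⊗-identityˡ : ∀ x → 1i ⊗ x ≡ x
⊗-identityˡ (a +i b) = ℚi-≡
  (ℚ-Solver.solve 2 (λ a b → reᴱ (1ᴱ ⊗ᴱ (a , b) , (a , b))) refl a b)
  (ℚ-Solver.solve 2 (λ a b → imᴱ (1ᴱ ⊗ᴱ (a , b) , (a , b))) refl a b)

⊗-zeroˡ : ∀ x → 0i ⊗ x ≡ 0i
⊗-zeroˡ (a +i b) = ℚi-≡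
  (ℚ-Solver.solve 2 (λ a b → reᴱ (0ᴱ ⊗ᴱ (a , b) , 0ᴱ)) refl a b)
  (ℚ-Solver.solve 2 (λ a b → imᴱ (0ᴱ ⊗ᴱ (a , b) , 0ᴱ)) refl a b)

⊗-distribʳ-⊕ : ∀ x y z → (y ⊕ z) ⊗ x ≡ y ⊗ x ⊕ z ⊗ x
⊗-distribʳ-⊕ (a +i b) (c +i d) (e +i f) = ℚi-≡
  (ℚ-Solver.solve 6 (λ a b c d e f → reᴱ (((c , d) ⊕ᴱ (e , f)) ⊗ᴱ (a , b) , (c , d) ⊗ᴱ (a , b) ⊕ᴱ (e , f) ⊗ᴱ (a , b))) refl a b c d e f)
  (ℚ-Solver.solve 6 (λ a b c d e f → imᴱ (((c , d) ⊕ᴱ (e , f)) ⊗ᴱ (a , b) , (c , d) ⊗ᴱ (a , b) ⊕ᴱ (e , f) ⊗ᴱ (a , b))) refl a b c d e f)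

⊝-distribˡ-⊗ : ∀ x y → (⊝ x) ⊗ y ≡ ⊝ (x ⊗ y)
⊝-distribˡ-⊗ (a +i b) (c +i d) = ℚi-≡
  (ℚ-Solver.solve 4 (λ a b c d → reᴱ ((⊝ᴱ (a , b)) ⊗ᴱ (c , d) , ⊝ᴱ ((a , b) ⊗ᴱ (c , d)))) refl a b c d)
  (ℚ-Solver.solve 4 (λ a b c d → imᴱ ((⊝ᴱ (a , b)) ⊗ᴱ (c , d) , ⊝ᴱ ((a , b) ⊗ᴱ (c , d)))) refl a b c d)

⊝-⊕-comm : ∀ x y → (⊝ x) ⊕ (⊝ y) ≡ ⊝ (x ⊕ y)
⊝-⊕-comm (a +i b) (c +i d) = ℚi-≡
  (ℚ-Solver.solve 4 (λ a b c d → reᴱ ((⊝ᴱ (a , b)) ⊕ᴱ (⊝ᴱ (c , d)) , ⊝ᴱ ((a , b) ⊕ᴱ (c , d)))) refl a b c d)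
  (ℚ-Solver.solve 4 (λ a b c d → imᴱ ((⊝ᴱ (a , b)) ⊕ᴱ (⊝ᴱ (c , d)) , ⊝ᴱ ((a , b) ⊕ᴱ (c , d)))) refl a b c d)

⊕-identityʳ : ∀ x → x ⊕ 0i ≡ x
⊕-identityʳ x = trans (⊕-comm x 0i) (⊕-identityˡ x)

⊗-identityʳ : ∀ x → x ⊗ 1i ≡ x
⊗-identityʳ x = trans (⊗-comm x 1i) (⊗-identityˡ x)

⊕-isCommutativeMonoid : IsCommutativeMonoid _⊕_ 0i
⊕-isCommutativeMonoid = isCommutativeMonoidˡ record
  { isSemigroup = record { isMagma = record { isEquivalence = isEquivalence ; ∙-cong = cong₂ _⊕_ } ; assoc = ⊕-assoc }
  ; identityˡ = ⊕-identityˡ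
  ; comm = ⊕-comm
  }

⊗-isCommutativeMonoid : IsCommutativeMonoid _⊗_ 1i
⊗-isCommutativeMonoid = isCommutativeMonoidˡ record
  { isSemigroup = record { isMagma = record { isEquivalence = isEquivalence ; ∙-cong = cong₂ _⊗_ } ; assoc = ⊗-assoc }
  ; identityˡ = ⊗-identityˡ
  ; comm = ⊗-comm
  }

0i≟_ : (x : ℚi) → Maybe (0i ≡ x)
0i≟ (a +i b) with 0ℚ QP.≟ a | 0ℚ QP.≟ b
... | yes 0≡a | yes 0≡b = just (ℚi-≡ 0≡a 0≡b)
... | _       | _       = nothing

ℚi-almostCommutativeRing : AlmostCommutativeRing 0ℓ 0ℓ
ℚi-almostCommutativeRing = record
  { _≈_ = _≡_ ; _+_ = _⊕_ ; _*_ = _⊗_ ; -_ = ⊝_ ; 0# = 0i ; 1# = 1i ; 0≟_ = 0i≟_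
  ; isAlmostCommutativeRing = record
    { isCommutativeSemiring = isCommutativeSemiringˡ record
      { +-isCommutativeMonoid = ⊕-isCommutativeMonoid
      ; *-isCommutativeMonoid = ⊗-isCommutativeMonoid
      ; distribʳ = ⊗-distribʳ-⊕
      ; zeroˡ = ⊗-zeroˡ
      }
    ; -‿cong = cong ⊝_
    ; -‿*-distribˡ = ⊝-distribˡ-⊗
    ; -‿+-comm = ⊝-⊕-comm
    }
  }

module ℚi-Solver = RingSolver ℚi-almostCommutativeRing

·v-cong : ∀ M {v w : Vec3} → v ≗ w → M ·v v ≗ M ·v w
·v-cong M v≗w i rewrite v≗w zero | v≗w (suc zero) | v≗w (suc (suc zero)) = refl

·v-scale : ∀ M c w → M ·v (λ k → c ⊗ w k) ≗ (λ k → c ⊗ (M ·v w) k)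
·v-scale M c w i = ℚi-Solver.solve 7
  (λ m₀ m₁ m₂ c w₀ w₁ w₂ →
    m₀ :* (c :* w₀) :+ m₁ :* (c :* w₁) :+ m₂ :* (c :* w₂) ℚi-Solver.⊜ c :* (m₀ :* w₀ :+ m₁ :* w₁ :+ m₂ :* w₂))
  refl (M i zero) (M i (suc zero)) (M i (suc (suc zero))) c (w zero) (w (suc zero)) (w (suc (suc zero)))

·M-·v-assoc : ∀ A B v → (A ·M B) ·v v ≗ A ·v (B ·v v)
·M-·v-assoc A B v i = ℚi-Solver.solve 15
  (λ a₀ a₁ a₂ b₀₀ b₀₁ b₀₂ b₁₀ b₁₁ b₁₂ b₂₀ b₂₁ b₂₂ v₀ v₁ v₂ →
    ((a₀ :* b₀₀ :+ a₁ :* b₁₀ :+ a₂ :* b₂₀) :* v₀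
      :+ (a₀ :* b₀₁ :+ a₁ :* b₁₁ :+ a₂ :* b₂₁) :* v₁
      :+ (a₀ :* b₀₂ :+ a₁ :* b₁₂ :+ a₂ :* b₂₂) :* v₂)
    ℚi-Solver.⊜
    (a₀ :* (b₀₀ :* v₀ :+ b₀₁ :* v₁ :+ b₀₂ :* v₂)
      :+ a₁ :* (b₁₀ :* v₀ :+ b₁₁ :* v₁ :+ b₁₂ :* v₂)
      :+ a₂ :* (b₂₀ :* v₀ :+ b₂₁ :* v₁ :+ b₂₂ :* v₂)))
  refl (A i zero) (A i (suc zero)) (A i (suc (suc zero)))
       (B zero zero) (B zero (suc zero)) (B zero (suc (suc zero)))
       (B (suc zero) zero) (B (suc zero) (suc zero)) (B (suc zero) (suc (suc zero)))
       (B (suc (suc zero)) zero) (B (suc (suc zero)) (suc zero)) (B (suc (suc zero)) (suc (suc zero)))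
       (v zero) (v (suc zero)) (v (suc (suc zero)))

normSq-⊗ : ∀ x y → normSq (x ⊗ y) ≡ normSq x Q.* normSq y
normSq-⊗ (a +i b) (c +i d) =
  ℚ-Solver.solve 4 (λ a b c d → normSqᴱ ((a , b) ⊗ᴱ (c , d)) ⊜ normSqᴱ (a , b) :* normSqᴱ (c , d)) refl a b c d

infix 4 _∼_

-- Tracking normSq c ≢ 0ℚ rather than c ≢ 0i makes transitivity a consequence of
-- normSq-⊗ and the absence of zero divisors in ℚ.
_∼_ : Vec3 → Vec3 → Set
v ∼ w = ∃ λ c → normSq c ≢ 0ℚ × v ≗ (λ k → c ⊗ w k)

≗-∼-trans : ∀ {u v w} → u ≗ v → v ∼ w → u ∼ w
≗-∼-trans u≗v (c , c≢0 , v≗cw) = c , c≢0 , λ k → trans (u≗v k) (v≗cw k)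

∼-trans : ∀ {u v w} → u ∼ v → v ∼ w → u ∼ w
∼-trans {w = w} (c , c≢0 , u≗cv) (d , d≢0 , v≗dw) =
  c ⊗ d , (λ cd≡0 → x#0y#0→xy#0 c≢0 d≢0 (trans (sym (normSq-⊗ c d)) cd≡0)) ,
  λ k → trans (u≗cv k) (trans (cong (c ⊗_) (v≗dw k)) (sym (⊗-assoc c d (w k))))

·v-resp-∼ : ∀ M {v w} → v ∼ w → M ·v v ∼ M ·v w
·v-resp-∼ M {w = w} (c , c≢0 , v≗cw) = c , c≢0 , λ k → trans (·v-cong M v≗cw k) (·v-scale M c w k)

∼⇒≈P : ∀ {v w} → v ∼ w → v ≈P w
∼⇒≈P (c , c≢0 , v≗cw) = c , (λ c≡0 → c≢0 (cong normSq c≡0)) , v≗cw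

-- Aγ γ is siegelMatrix (toH γ) by definition.
siegelMatrix : H → Mat3
siegelMatrix p = mat3 (⊝ siegelβ p) (⊝ conj (siegelα p)) (⊝ 1i)
                      (siegelα p)   1i                    0i
                      (⊝ 1i)        0i                    0i

-- (−β : α : −1) in the Siegel coordinates (α , β) of r: the Siegel point of ι r
-- multiplied by −β.
inversionHom : H → Vec3
inversionHom r = vec3 (⊝ siegelβ r) (siegelα r) (⊝ 1i)

siegelMatrix-·v-siegelHom : ∀ g q → siegelMatrix g ·v siegelHom q ≗ inversionHom (g *H q)
siegelMatrix-·v-siegelHom ((a +i b) , c) ((x +i y) , s) zero = ℚi-≡
  (ℚ-Solver.solve 6 (λ a b c x y s → reᴱ (translationᴱ a b c x y s zero)) refl a b c x y s)
  (ℚ-Solver.solve 6 (λ a b c x y s → imᴱ (translationᴱ a b c x y s zero)) refl a b c x y s)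
siegelMatrix-·v-siegelHom ((a +i b) , c) ((x +i y) , s) (suc zero) = ℚi-≡
  (ℚ-Solver.solve 6 (λ a b c x y s → reᴱ (translationᴱ a b c x y s (suc zero))) refl a b c x y s)
  (ℚ-Solver.solve 6 (λ a b c x y s → imᴱ (translationᴱ a b c x y s (suc zero))) refl a b c x y s)
siegelMatrix-·v-siegelHom ((a +i b) , c) ((x +i y) , s) (suc (suc zero)) = ℚi-≡
  (ℚ-Solver.solve 6 (λ a b c x y s → reᴱ (translationᴱ a b c x y s (suc (suc zero)))) refl a b c x y s)
  (ℚ-Solver.solve 6 (λ a b c x y s → imᴱ (translationᴱ a b c x y s (suc (suc zero)))) refl a b c x y s)

-- ι r computed with the factor 1 / (|z|⁴ + t²) replaced by an arbitrary u.
inversionBy : ℚ → H → H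
inversionBy u (z , t) = scale u (⊝ z ⊗ conj (normSq z +i t)) , Q.- (t Q.* u)

ι≡just⇒inversionBy : ∀ r {r'} → ι r ≡ just r' →
  ∃ λ u → gauge4 r Q.* u ≡ 1ℚ × gauge4 r ≢ 0ℚ × r' ≡ inversionBy u r
ι≡just⇒inversionBy r ι≡r' with gauge4 r QP.≟ 0ℚ
ι≡just⇒inversionBy r () | yes _
ι≡just⇒inversionBy r refl | no N≢0 =
  let instance _ = ≢-nonZero N≢0 in Q.1/ gauge4 r , QP.*-inverseʳ (gauge4 r) , N≢0 , refl

-- Identities that hold only where N u = 1 are stated as polynomial identities with an
-- explicit multiple of N u − 1, which this lemma then removes.
⊕-multiple-vanishes : ∀ {N u} → N Q.* u ≡ 1ℚ → ∀ a h → a ⊕ ofℚ (N Q.* u Q.- 1ℚ) ⊗ h ≡ a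
⊕-multiple-vanishes Nu≡1 a h rewrite Nu≡1 = trans (cong (a ⊕_) (⊗-zeroˡ h)) (⊕-identityʳ a)

siegelα-inversionBy : ∀ u r →
  (⊝ siegelβ r) ⊗ siegelα (inversionBy u r) ≡ siegelα r ⊕ ofℚ (gauge4 r Q.* u Q.- 1ℚ) ⊗ siegelα r
siegelα-inversionBy u ((x +i y) , t) = ℚi-≡
  (ℚ-Solver.solve 4 (λ x y t u → reᴱ (lhs x y t u , rhs x y t u)) refl x y t u)
  (ℚ-Solver.solve 4 (λ x y t u → imᴱ (lhs x y t u , rhs x y t u)) refl x y t u)
  where
  lhs rhs : ∀ {n} (x y t u : Expr ℚ n) → ℚiExpr
  lhs x y t u = (⊝ᴱ siegelβᴱ ((x , y) , t)) ⊗ᴱ siegelαᴱ (inversionByᴱ u ((x , y) , t))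
  rhs x y t u = siegelαᴱ ((x , y) , t)
    ⊕ᴱ ofℚᴱ (gauge4ᴱ ((x , y) , t) :* u :+ :- Κ 1ℚ) ⊗ᴱ siegelαᴱ ((x , y) , t)

siegelβ-inversionBy : ∀ u r →
  (⊝ siegelβ r) ⊗ siegelβ (inversionBy u r)
    ≡ ⊝ 1i ⊕ ofℚ (gauge4 r Q.* u Q.- 1ℚ) ⊗ ⊝ (1i ⊕ ofℚ (u Q.* normSq (proj₁ r)) ⊗ siegelβ r)
siegelβ-inversionBy u ((x +i y) , t) = ℚi-≡
  (ℚ-Solver.solve 4 (λ x y t u → reᴱ (lhs x y t u , rhs x y t u)) refl x y t u)
  (ℚ-Solver.solve 4 (λ x y t u → imᴱ (lhs x y t u , rhs x y t u)) refl x y t u)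
  where
  lhs rhs : ∀ {n} (x y t u : Expr ℚ n) → ℚiExpr
  lhs x y t u = (⊝ᴱ siegelβᴱ ((x , y) , t)) ⊗ᴱ siegelβᴱ (inversionByᴱ u ((x , y) , t))
  rhs x y t u = ⊝ᴱ 1ᴱ ⊕ᴱ ofℚᴱ (gauge4ᴱ ((x , y) , t) :* u :+ :- Κ 1ℚ)
    ⊗ᴱ ⊝ᴱ (1ᴱ ⊕ᴱ ofℚᴱ (u :* normSqᴱ (x , y)) ⊗ᴱ siegelβᴱ ((x , y) , t))

normSq-⊝siegelβ : ∀ r → normSq (⊝ siegelβ r) ≡ gauge4 r
normSq-⊝siegelβ ((x +i y) , t) = ℚ-Solver.solve 3
  (λ x y t → normSqᴱ (⊝ᴱ siegelβᴱ ((x , y) , t)) ⊜ gauge4ᴱ ((x , y) , t)) refl x y t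

inversionHom-∼-ι : ∀ r {r'} → ι r ≡ just r' → inversionHom r ∼ siegelHom r'
inversionHom-∼-ι r ι≡r' with ι≡just⇒inversionBy r ι≡r'
... | u , Nu≡1 , N≢0 , refl = ⊝ siegelβ r , N≢0 ∘ trans (sym (normSq-⊝siegelβ r)) , λ where
  zero → sym (⊗-identityʳ (⊝ siegelβ r))
  (suc zero) → sym (trans (siegelα-inversionBy u r) (⊕-multiple-vanishes {gauge4 r} Nu≡1 _ _))
  (suc (suc zero)) → sym (trans (siegelβ-inversionBy u r) (⊕-multiple-vanishes {gauge4 r} Nu≡1 _ _))

siegelMatrix-·M-∼-ι : ∀ g P {q p} → P ·v e₀ ∼ siegelHom q → ι (g *H q) ≡ just p →
  (siegelMatrix g ·M P) ·v e₀ ∼ siegelHom p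
siegelMatrix-·M-∼-ι g P {q} Pe₀∼q ι≡p =
  ≗-∼-trans (·M-·v-assoc (siegelMatrix g) P e₀)
    (∼-trans (·v-resp-∼ (siegelMatrix g) Pe₀∼q)
      (≗-∼-trans (siegelMatrix-·v-siegelHom g q) (inversionHom-∼-ι (g *H q) ι≡p)))

>>=-≡-just : ∀ {A B : Set} (m : Maybe A) {f : A → Maybe B} {b} →
  (m >>= f) ≡ just b → ∃ λ a → m ≡ just a × f a ≡ just b
>>=-≡-just nothing ()
>>=-≡-just (just a) fa≡b = a , refl , fa≡b

origin : H
origin = 0i , 0ℚ

*H-identityʳ : ∀ g → g *H origin ≡ g
*H-identityʳ (z@(a +i b) , c) = cong₂ _,_ (⊕-identityʳ z)
  (ℚ-Solver.solve 3 (λ a b c → proj₂ (((a , b) , c) *Hᴱ (0ᴱ , Κ 0ℚ)) ⊜ c) refl a b c)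

I3·e₀∼siegelHom-origin : I3 ·v e₀ ∼ siegelHom origin
I3·e₀∼siegelHom-origin = 1i , QP.1≢0 , λ where
  zero → refl
  (suc zero) → refl
  (suc (suc zero)) → refl

prodM-Aγ-·v-e₀ : ∀ γ γs {p} → K γ γs ≡ just p → prodM (map Aγ (γ ∷ γs)) ·v e₀ ∼ siegelHom p
prodM-Aγ-·v-e₀ γ [] {p} K≡p = siegelMatrix-·M-∼-ι (toH γ) I3 I3·e₀∼siegelHom-origin
  (subst (λ g → ι g ≡ just p) (sym (*H-identityʳ (toH γ))) K≡p)
prodM-Aγ-·v-e₀ γ (δ ∷ δs) K≡p =
  let q , K≡q , ι≡p = >>=-≡-just (K δ δs) K≡p
  in siegelMatrix-·M-∼-ι (toH γ) (prodM (map Aγ (δ ∷ δs))) (prodM-Aγ-·v-e₀ δ δs K≡q) ι≡p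

lemma3p9 : (γ₁ : Hℤ) (γs : List Hℤ) (p : H) → K γ₁ γs ≡ just p →
    (prodM (map Aγ (γ₁ ∷ γs)) ·v e₀) ≈P siegelHom p
lemma3p9 γ₁ γs p K≡p = ∼⇒≈P (prodM-Aγ-·v-e₀ γ₁ γs K≡p)
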